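{- Let $K_n^3$ denote the complete $3$-uniform hypergraph on $n$ vertices. Then $$\chi^c(K_7^3,3,3,3)=\chi^c(K_8^3,3,3,3)=\chi^c(K_9^3,3,3,3)=4.$$
   Context: For a $k$-uniform hypergraph $G=(V,E)$ (every hyperedge is a $k$-element subset of the finite set $V$), an $r$-coloring is a map $V\to\{1,\dots,r\}$. A hyperedge $e$ is properly $(r,p)$ colored by an $r$-coloring if $e$ contains at least $\min(p,|e|)$ vertices of pairwise distinct colors. A strong $(r,p)$ cover of $G$ is a set $C$ of $r$-colorings of $V$ such that every hyperedge of $G$ is properly $(r,p)$ colored by at least one coloring in $C$. The strong $(r,p)$ cover number $\chi^c(G,k,r,p)$ is the minimum cardinality of a strong $(r,p)$ cover of $G$. $K_n^k$ denotes the complete $k$-uniform hypergraph on $n$ vertices (all $k$-subsets are hyperedges). -}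

module Defs where

open import Data.Nat using (ℕ; _≤_; _⊓_)
open import Data.Fin using (Fin)
open import Data.Fin.Subset using (Subset; _⊆_; _∈_; ∣_∣)
open import Data.List using (List; length)
open import Data.List.Relation.Unary.Any using (Any)
open import Data.Product using (Σ; _×_)
open import Relation.Binary.PropositionalEquality using (_≡_)

Hypergraph : ℕ → Set₁
Hypergraph n = Subset n → Set

IsUniform : ∀ {n} → ℕ → Hypergraph n → Set
IsUniform k E = ∀ e → E e → ∣ e ∣ ≡ k

Complete : (n k : ℕ) → Hypergraph n
Complete n k e = ∣ e ∣ ≡ k

Coloring : ℕ → ℕ → Set
Coloring n r = Fin n → Fin r

ProperlyColored : ∀ {n r} → ℕ → Coloring n r → Subset n → Set
ProperlyColored {n} p c e =
  Σ (Subset n) λ S →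
    (S ⊆ e) × ((p ⊓ ∣ e ∣) ≤ ∣ S ∣)
      × (∀ {i j} → i ∈ S → j ∈ S → c i ≡ c j → i ≡ j)

IsStrongCover : ∀ {n} → Hypergraph n → (r p : ℕ) → List (Coloring n r) → Set
IsStrongCover E r p C = ∀ e → E e → Any (λ c → ProperlyColored p c e) C

-- χ^c(G,k,r,p) = m : m is the minimum cardinality of a strong (r,p) cover
-- of the k-uniform hypergraph G.
CoverNumberIs : ∀ {n} → (G : Hypergraph n) → (k r p : ℕ) → ℕ → Set
CoverNumberIs G k r p m =
  IsUniform k G
    × (Σ (List (Coloring _ r)) λ C → (length C ≡ m) × IsStrongCover G r p C)
    × (∀ (C : List (Coloring _ r)) → IsStrongCover G r p C → m ≤ length C)

module Submission where

-- Four explicit 3-colourings of nine vertices make every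
-- triple rainbow under at least one of them; restricting them to the first
-- seven or eight vertices keeps this property.  Rainbowness of a triple is
-- decidable, so each of the three cover claims is checked by evaluating a
-- decision procedure over all subsets of the vertex set.
--
-- A triple with two vertices of equal colour is not properly
-- (3,3) coloured.  Given a 3-colouring c of a vertex set X, deleting the
-- colour class of one colour leaves a set of size at least 2|X|/3 (the three
-- complements of the colour classes have total size 2|X|), and in it every
-- triple repeats a colour of c by the pigeonhole principle.  Iterating this
-- over a list of m colourings shows that any set of at least
-- threshold m vertices contains a triple that is not rainbow under any of
-- them, where threshold 0 = 3 and threshold (m+1) = ⌈(3·threshold m - 2)/2⌉.
-- Since threshold 3 = 7, three colourings never cover K_n^3 when n ≥ 7.

open import Defs
open import Data.Bool using (if_then_else_)
open import Data.Empty using (⊥-elim)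
open import Data.Fin using (Fin; zero; suc; punchOut; inject≤; #_) renaming (_<_ to _<ᶠ_)
open import Data.Fin.Properties using (pigeonhole; punchOut-injective; suc-injective; <⇒≢; all?)
  renaming (_≟_ to _≟ᶠ_)
open import Data.Fin.Subset using (Subset; _⊆_; _∈_; ∣_∣; inside; outside; ⊤)
open import Data.Fin.Subset.Properties
  using (_∈?_; p⊂q⇒∣p∣<∣q∣; out⊆; in⊆in; ∣⊤∣≡n; anySubset?)
open import Data.List using (List; []; _∷_; length; map)
open import Data.List.Relation.Unary.All using (All; []; _∷_)
import Data.List.Relation.Unary.All as All
open import Data.List.Relation.Unary.All.Properties using (All¬⇒¬Any)
open import Data.List.Relation.Unary.Any using (Any; any?)
import Data.List.Relation.Unary.Any as Any
open import Data.Nat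
  using (ℕ; zero; suc; _+_; _*_; _∸_; _≤_; _<_; ⌊_/2⌋; ⌈_/2⌉; z≤n; s≤s; _≤?_)
  renaming (_≟_ to _≟ⁿ_)
open import Data.Nat.Properties
  using (≤-refl; ≤-trans; ≤-reflexive; ≤-pred; ≤ᵇ⇒≤; ≰⇒>; <⇒≱; <-irrefl;
         +-mono-≤; +-monoʳ-≤; +-monoˡ-≤; *-monoʳ-≤; +-identityʳ; n<1+n; m≤n+m∸n;
         m≥n⇒m⊓n≡n; m⊓n≤n; ⌊n/2⌋≤⌈n/2⌉; ⌊n/2⌋+⌈n/2⌉≡n; module ≤-Reasoning)
open import Data.Nat.Tactic.RingSolver using (solve-∀)
open import Data.Product using (Σ; ∃; ∃₂; _×_; _,_)
open import Data.Vec using (Vec; []; _∷_; lookup)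
open import Data.Vec.Base using (here; there)
open import Function using (_∘_)
open import Relation.Nullary using (Dec; yes; no; ¬_; does)
open import Relation.Nullary.Decidable
  using (False; toWitnessFalse; decidable-stable; ¬?; _→-dec_)
open import Relation.Binary.PropositionalEquality
  using (_≡_; _≢_; refl; sym; trans; cong; subst)

Collision : ∀ {n} {A : Set} → (Fin n → A) → Subset n → Set
Collision {n} f e = ∃₂ λ (i j : Fin n) → i ∈ e × j ∈ e × i ≢ j × f i ≡ f j

-- A set with a colour collision is not properly (r,p) coloured as soon as
-- p ≥ |e|: a rainbow subset of e would have to be all of e.
collision⇒¬proper : ∀ {n r p} {c : Coloring n r} {e : Subset n} →
  ∣ e ∣ ≤ p → Collision c e → ¬ ProperlyColored p c e
collision⇒¬proper {e = e} ∣e∣≤p (i , j , i∈e , j∈e , i≢j , ci≡cj) (S , S⊆e , bound , rainbow) =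
  i≢j (rainbow (e⊆S i∈e) (e⊆S j∈e) ci≡cj)
  where
  e≤S : ∣ e ∣ ≤ ∣ S ∣
  e≤S = subst (_≤ ∣ S ∣) (m≥n⇒m⊓n≡n ∣e∣≤p) bound
  e⊆S : e ⊆ S
  e⊆S {x} x∈e with x ∈? S
  ... | yes x∈S = x∈S
  ... | no x∉S = ⊥-elim (<⇒≱ (p⊂q⇒∣p∣<∣q∣ (S⊆e , x , x∈e , x∉S)) e≤S)

element : ∀ {n} (e : Subset n) → Fin ∣ e ∣ → Fin n
element (inside ∷ e) zero = zero
element (inside ∷ e) (suc k) = suc (element e k)
element (outside ∷ e) k = suc (element e k)

element-∈ : ∀ {n} (e : Subset n) k → element e k ∈ e
element-∈ (inside ∷ e) zero = here
element-∈ (inside ∷ e) (suc k) = there (element-∈ e k)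
element-∈ (outside ∷ e) k = there (element-∈ e k)

element-injective : ∀ {n} (e : Subset n) {k l} → element e k ≡ element e l → k ≡ l
element-injective (inside ∷ e) {zero} {zero} _ = refl
element-injective (inside ∷ e) {suc k} {suc l} eq = cong suc (element-injective e (suc-injective eq))
element-injective (outside ∷ e) eq = element-injective e (suc-injective eq)

missingColour⇒collision : ∀ {n r} (c : Coloring n (suc r)) (a : Fin (suc r)) (e : Subset n) →
  (∀ {i} → i ∈ e → c i ≢ a) → r < ∣ e ∣ → Collision c e
missingColour⇒collision {r = r} c a e misses r<∣e∣ = collisionAt (pigeonhole r<∣e∣ reducedColour)
  where
  a≢colour : ∀ k → a ≢ c (element e k)
  a≢colour k = misses (element-∈ e k) ∘ sym
  -- the colour of the k-th element, renumbered within the r colours other than a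
  reducedColour : Fin ∣ e ∣ → Fin r
  reducedColour k = punchOut (a≢colour k)
  collisionAt : (∃₂ λ k l → k <ᶠ l × reducedColour k ≡ reducedColour l) → Collision c e
  collisionAt (k , l , k<l , same) =
    element e k , element e l , element-∈ e k , element-∈ e l ,
    (λ eq → <⇒≢ k<l (element-injective e eq)) ,
    punchOut-injective (a≢colour k) (a≢colour l) same

withoutColour : ∀ {n r} → Coloring n r → Fin r → Subset n → Subset n
withoutColour c a [] = []
withoutColour c a (b ∷ X) =
  (if does (c zero ≟ᶠ a) then outside else b) ∷ withoutColour (c ∘ suc) a X

withoutColour-⊆ : ∀ {n r} (c : Coloring n r) a X → withoutColour c a X ⊆ X
withoutColour-⊆ c a (b ∷ X) i∈ with c zero ≟ᶠ a | i∈
... | yes _ | there i∈′ = there (withoutColour-⊆ (c ∘ suc) a X i∈′)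
... | no _  | here = here
... | no _  | there i∈′ = there (withoutColour-⊆ (c ∘ suc) a X i∈′)

withoutColour-misses : ∀ {n r} (c : Coloring n r) a X {i} →
  i ∈ withoutColour c a X → c i ≢ a
withoutColour-misses c a (b ∷ X) i∈ with c zero ≟ᶠ a | i∈
... | yes _   | there i∈′ = withoutColour-misses (c ∘ suc) a X i∈′
... | no ca≢a | here = ca≢a
... | no _    | there i∈′ = withoutColour-misses (c ∘ suc) a X i∈′

-- A new vertex of X lies in the two complements of the classes it does not
-- belong to, so it raises the total size of the complements by 2.
addTwo : ∀ {s s′ m} → s′ ≡ 2 + s → s ≡ 2 * m → s′ ≡ 2 * suc m
addTwo {m = m} s′≡2+s s≡2m = trans s′≡2+s (trans (cong (2 +_) s≡2m) (twice-suc m))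
  where
  twice-suc : ∀ m → 2 + 2 * m ≡ 2 * suc m
  twice-suc = solve-∀

ComplementSizes : Set
ComplementSizes = Fin 3 → ℕ

total : ComplementSizes → ℕ
total s = s zero + s (suc zero) + s (suc (suc zero))

newVertex₀ : ∀ {m} (s : ComplementSizes) → total s ≡ 2 * m →
  s zero + suc (s (suc zero)) + suc (s (suc (suc zero))) ≡ 2 * suc m
newVertex₀ s = addTwo (shift (s zero) (s (suc zero)) (s (suc (suc zero))))
  where
  shift : ∀ x y z → x + suc y + suc z ≡ 2 + (x + y + z)
  shift = solve-∀

newVertex₁ : ∀ {m} (s : ComplementSizes) → total s ≡ 2 * m →
  suc (s zero) + s (suc zero) + suc (s (suc (suc zero))) ≡ 2 * suc m
newVertex₁ s = addTwo (shift (s zero) (s (suc zero)) (s (suc (suc zero))))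
  where
  shift : ∀ x y z → suc x + y + suc z ≡ 2 + (x + y + z)
  shift = solve-∀

newVertex₂ : ∀ {m} (s : ComplementSizes) → total s ≡ 2 * m →
  suc (s zero) + suc (s (suc zero)) + s (suc (suc zero)) ≡ 2 * suc m
newVertex₂ s = addTwo (shift (s zero) (s (suc zero)) (s (suc (suc zero))))
  where
  shift : ∀ x y z → suc x + suc y + z ≡ 2 + (x + y + z)
  shift = solve-∀

complementSize : ∀ {n} → Coloring n 3 → Subset n → ComplementSizes
complementSize c X a = ∣ withoutColour c a X ∣

-- Each vertex of X lies in exactly two of the three colour-class complements,
-- so the complements have total size 2|X|.
complements-total : ∀ {n} (c : Coloring n 3) X → total (complementSize c X) ≡ 2 * ∣ X ∣
complements-total c [] = refl
complements-total c (outside ∷ X) with c zero | complements-total (c ∘ suc) X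
... | zero           | sum = sum
... | suc zero       | sum = sum
... | suc (suc zero) | sum = sum
complements-total c (inside ∷ X) with c zero | complements-total (c ∘ suc) X
... | zero           | sum = newVertex₀ (complementSize (c ∘ suc) X) sum
... | suc zero       | sum = newVertex₁ (complementSize (c ∘ suc) X) sum
... | suc (suc zero) | sum = newVertex₂ (complementSize (c ∘ suc) X) sum

someComplementLarge : ∀ (s : ComplementSizes) {t m} → total s ≡ 2 * m →
  3 * t ≤ 2 + 2 * m → ∃ λ a → t ≤ s a
someComplementLarge s {t} {m} sum bound
  with t ≤? s zero | t ≤? s (suc zero) | t ≤? s (suc (suc zero))
... | yes large | _ | _ = zero , large
... | no _ | yes large | _ = suc zero , large
... | no _ | no _ | yes large = suc (suc zero) , large
... | no small₀ | no small₁ | no small₂ = ⊥-elim (<-irrefl refl tooLarge)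
  where
  open ≤-Reasoning
  regroup : ∀ x y z → 3 + (x + y + z) ≡ suc x + (suc y + (suc z + 0))
  regroup = solve-∀
  tooLarge : 2 + 2 * m < 2 + 2 * m
  tooLarge = begin-strict
    2 + 2 * m     ≡⟨ cong (2 +_) (sym sum) ⟩
    2 + total s   <⟨ n<1+n (2 + total s) ⟩
    3 + total s   ≡⟨ regroup (s zero) (s (suc zero)) (s (suc (suc zero))) ⟩
    suc (s zero) + (suc (s (suc zero)) + (suc (s (suc (suc zero))) + 0))
                  ≤⟨ +-mono-≤ (≰⇒> small₀) (+-mono-≤ (≰⇒> small₁) (+-mono-≤ (≰⇒> small₂) z≤n)) ⟩
    3 * t         ≤⟨ bound ⟩
    2 + 2 * m     ∎

largeComplement : ∀ {n} (c : Coloring n 3) X {t} → 3 * t ≤ 2 + 2 * ∣ X ∣ →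
  ∃ λ a → t ≤ ∣ withoutColour c a X ∣
largeComplement c X = someComplementLarge (complementSize c X) {m = ∣ X ∣} (complements-total c X)

subsetOfSize : ∀ {n} k (X : Subset n) → k ≤ ∣ X ∣ → Σ (Subset n) λ e → e ⊆ X × ∣ e ∣ ≡ k
subsetOfSize zero [] z≤n = [] , (λ ()) , refl
subsetOfSize zero (b ∷ X) z≤n with subsetOfSize zero X z≤n
... | e , e⊆X , ∣e∣≡0 = outside ∷ e , out⊆ e⊆X , ∣e∣≡0
subsetOfSize (suc k) (inside ∷ X) (s≤s k≤∣X∣) with subsetOfSize k X k≤∣X∣
... | e , e⊆X , ∣e∣≡k = inside ∷ e , in⊆in e⊆X , cong suc ∣e∣≡k
subsetOfSize (suc k) (outside ∷ X) k<∣X∣ with subsetOfSize (suc k) X k<∣X∣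
... | e , e⊆X , ∣e∣≡k = outside ∷ e , out⊆ e⊆X , ∣e∣≡k

-- Number of vertices guaranteeing, for any m 3-colourings, a triple that is
-- rainbow under none of them; each colouring costs a factor of about 3/2.
threshold : ℕ → ℕ
threshold zero = 3
threshold (suc m) = ⌈ 3 * threshold m ∸ 2 /2⌉

-- The recursion is chosen so that 3 · threshold m ≤ 2 · threshold (m+1) + 2,
-- exactly what largeComplement needs to pass from m+1 colourings to m.
n≤2*⌈n/2⌉ : ∀ n → n ≤ 2 * ⌈ n /2⌉
n≤2*⌈n/2⌉ n = begin
  n                       ≡⟨ sym (⌊n/2⌋+⌈n/2⌉≡n n) ⟩
  ⌊ n /2⌋ + ⌈ n /2⌉       ≤⟨ +-monoˡ-≤ ⌈ n /2⌉ (⌊n/2⌋≤⌈n/2⌉ n) ⟩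
  ⌈ n /2⌉ + ⌈ n /2⌉       ≡⟨ cong (⌈ n /2⌉ +_) (sym (+-identityʳ ⌈ n /2⌉)) ⟩
  2 * ⌈ n /2⌉             ∎
  where open ≤-Reasoning

threshold-step : ∀ m → 3 * threshold m ≤ 2 + 2 * threshold (suc m)
threshold-step m =
  ≤-trans (m≤n+m∸n (3 * threshold m) 2) (+-monoʳ-≤ 2 (n≤2*⌈n/2⌉ (3 * threshold m ∸ 2)))

nonRainbowTriple : ∀ {n} (C : List (Coloring n 3)) (X : Subset n) → threshold (length C) ≤ ∣ X ∣ →
  Σ (Subset n) λ e → e ⊆ X × ∣ e ∣ ≡ 3 × All (λ c → Collision c e) C
nonRainbowTriple [] X large with subsetOfSize 3 X large
... | e , e⊆X , ∣e∣≡3 = e , e⊆X , ∣e∣≡3 , []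
nonRainbowTriple (c ∷ C) X large
  with largeComplement c X (≤-trans (threshold-step (length C)) (+-monoʳ-≤ 2 (*-monoʳ-≤ 2 large)))
... | a , large′ with nonRainbowTriple C (withoutColour c a X) large′
... | e , e⊆X′ , ∣e∣≡3 , collisions =
  e , withoutColour-⊆ c a X ∘ e⊆X′ , ∣e∣≡3 ,
  missingColour⇒collision c a e (withoutColour-misses c a X ∘ e⊆X′) (≤-reflexive (sym ∣e∣≡3))
    ∷ collisions

belowThreshold⇒¬cover : ∀ {n} (C : List (Coloring n 3)) → threshold (length C) ≤ n →
  ¬ IsStrongCover (Complete n 3) 3 3 C
belowThreshold⇒¬cover {n} C large cover
  with nonRainbowTriple C ⊤ (≤-trans large (≤-reflexive (sym (∣⊤∣≡n n))))
... | e , _ , ∣e∣≡3 , collisions =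
  All¬⇒¬Any (All.map (collision⇒¬proper (≤-reflexive ∣e∣≡3)) collisions) (cover e ∣e∣≡3)

threshold≤7 : ∀ {m} → m ≤ 3 → threshold m ≤ 7
threshold≤7 {0} _ = ≤ᵇ⇒≤ 3 7 _
threshold≤7 {1} _ = ≤ᵇ⇒≤ 4 7 _
threshold≤7 {2} _ = ≤ᵇ⇒≤ 5 7 _
threshold≤7 {3} _ = ≤-refl
threshold≤7 {suc (suc (suc (suc _)))} (s≤s (s≤s (s≤s ())))

lowerBound : ∀ {n} → 7 ≤ n → (C : List (Coloring n 3)) → IsStrongCover (Complete n 3) 3 3 C → 4 ≤ length C
lowerBound 7≤n C cover with 4 ≤? length C
... | yes 4≤∣C∣ = 4≤∣C∣
... | no 4≰∣C∣ =
  ⊥-elim (belowThreshold⇒¬cover C (≤-trans (threshold≤7 (≤-pred (≰⇒> 4≰∣C∣))) 7≤n) cover)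

Rainbow : ∀ {n r} → Coloring n r → Subset n → Set
Rainbow c e = ∀ i j → i ∈ e → j ∈ e → c i ≡ c j → i ≡ j

rainbow? : ∀ {n r} (c : Coloring n r) e → Dec (Rainbow c e)
rainbow? c e = all? λ i → all? λ j →
  (i ∈? e) →-dec ((j ∈? e) →-dec ((c i ≟ᶠ c j) →-dec (i ≟ᶠ j)))

rainbow⇒proper : ∀ {n r p} {c : Coloring n r} {e : Subset n} → Rainbow c e → ProperlyColored p c e
rainbow⇒proper {p = p} {e = e} rainbow = e , (λ i∈e → i∈e) , m⊓n≤n p ∣ e ∣ , λ {i} {j} → rainbow i j

RainbowCovered : ∀ {n r} → ℕ → List (Coloring n r) → Subset n → Set
RainbowCovered k C e = ∣ e ∣ ≡ k → Any (λ c → Rainbow c e) C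

rainbowCovered? : ∀ {n r} k (C : List (Coloring n r)) e → Dec (RainbowCovered k C e)
rainbowCovered? k C e = (∣ e ∣ ≟ⁿ k) →-dec any? (λ c → rainbow? c e) C

certifiedCover : ∀ {n r} k p (C : List (Coloring n r)) →
  False (anySubset? (λ e → ¬? (rainbowCovered? k C e))) → IsStrongCover (Complete n k) r p C
certifiedCover k p C noFailure e ∣e∣≡k =
  Any.map rainbow⇒proper (decidable-stable (rainbowCovered? k C e) notFailing ∣e∣≡k)
  where
  notFailing : ¬ ¬ RainbowCovered k C e
  notFailing failing = toWitnessFalse noFailure (e , failing)

palettes : List (Vec (Fin 3) 9)
palettes =
    (# 1 ∷ # 1 ∷ # 2 ∷ # 0 ∷ # 0 ∷ # 1 ∷ # 2 ∷ # 2 ∷ # 0 ∷ [])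
  ∷ (# 2 ∷ # 1 ∷ # 0 ∷ # 0 ∷ # 2 ∷ # 0 ∷ # 1 ∷ # 2 ∷ # 1 ∷ [])
  ∷ (# 1 ∷ # 2 ∷ # 2 ∷ # 1 ∷ # 2 ∷ # 0 ∷ # 1 ∷ # 0 ∷ # 0 ∷ [])
  ∷ (# 2 ∷ # 0 ∷ # 2 ∷ # 0 ∷ # 1 ∷ # 1 ∷ # 1 ∷ # 0 ∷ # 2 ∷ [])
  ∷ []

coverOn : ∀ {n} → n ≤ 9 → List (Coloring n 3)
coverOn n≤9 = map (λ v i → lookup v (inject≤ i n≤9)) palettes

coverNumber≡4 : ∀ {n} → 7 ≤ n → (C : List (Coloring n 3)) → length C ≡ 4 →
  IsStrongCover (Complete n 3) 3 3 C → CoverNumberIs (Complete n 3) 3 3 3 4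
coverNumber≡4 7≤n C ∣C∣≡4 cover = (λ _ ∣e∣≡3 → ∣e∣≡3) , (C , ∣C∣≡4 , cover) , lowerBound 7≤n

mainTheorem1 : CoverNumberIs (Complete 7 3) 3 3 3 4
    × CoverNumberIs (Complete 8 3) 3 3 3 4
    × CoverNumberIs (Complete 9 3) 3 3 3 4
mainTheorem1 =
    coverNumber≡4 ≤-refl (coverOn 7≤9) refl (certifiedCover 3 3 (coverOn 7≤9) _)
  , coverNumber≡4 7≤8 (coverOn 8≤9) refl (certifiedCover 3 3 (coverOn 8≤9) _)
  , coverNumber≡4 7≤9 (coverOn ≤-refl) refl (certifiedCover 3 3 (coverOn ≤-refl) _)
  where
  7≤8 : 7 ≤ 8
  7≤8 = ≤ᵇ⇒≤ 7 8 _
  7≤9 : 7 ≤ 9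
  7≤9 = ≤ᵇ⇒≤ 7 9 _
  8≤9 : 8 ≤ 9
  8≤9 = ≤ᵇ⇒≤ 8 9 _
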